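{- For all integers $n,m\geq 1$, the graph $G_{n,m}$ has diameter $3$ and radius $2$.
   Context: For integers $n,m\geq 1$, the graph $G_{n,m}$ has vertex set $\{v_0,v_1,\ldots,v_{8m}\}\cup\{u_{i,j}: 1\le i\le n+5m,\ 1\le j\le 8m\}\cup\{w_{i,j}: 1\le i\le n+5m,\ 1\le j\le 8m\}$ (all distinct), and its edges are exactly: $v_0v_j$ for all $1\le j\le 8m$; $v_ju_{i,j}$ and $v_jw_{i,j}$ for all $1\le i\le n+5m$, $1\le j\le 8m$; and $u_{i,j}w_{i,j'}$ for all $1\le i\le n+5m$ and all $1\le j,j'\le 8m$ with $j\neq j'$. The diameter is the maximum distance between two vertices and the radius is $\min_u\max_v d(u,v)$. -}

module Defs where

open import Data.Nat using (ℕ; zero; suc; _+_; _*_; _≤_; _<_)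
open import Data.Fin using (Fin)
import Data.Fin as F
open import Data.Product using (Σ; _×_; ∃; ∃-syntax)
open import Data.Sum using (_⊎_)
open import Relation.Binary.PropositionalEquality using (_≡_; _≢_)
open import Relation.Nullary using (¬_)

record Graph : Set₁ where
  field
    Vertex : Set
    Adj    : Vertex → Vertex → Set

module _ (G : Graph) where
  open Graph G

  data Walk : Vertex → Vertex → ℕ → Set where
    nil  : ∀ {x} → Walk x x 0
    cons : ∀ {x y z k} → Adj x y → Walk y z k → Walk x z (suc k)

  IsDist : Vertex → Vertex → ℕ → Set
  IsDist x y k = Walk x y k × (∀ j → j < k → ¬ Walk x y j)

  IsEcc : Vertex → ℕ → Set
  IsEcc x e = (∀ y → ∃[ k ] (k ≤ e × IsDist x y k)) × (∃[ y ] IsDist x y e)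

  HasDiameter : ℕ → Set
  HasDiameter d = (∀ x y → ∃[ k ] (k ≤ d × IsDist x y k))
                × (∃[ x ] ∃[ y ] IsDist x y d)

  HasRadius : ℕ → Set
  HasRadius r = (∃[ x ] IsEcc x r) × (∀ x e → IsEcc x e → r ≤ e)

-- The graph G_{n,m}
-- v j  (j : Fin (1 + 8m))     ~ v_j       (v zero = v_0, v (suc j) = v_{j+1})
-- u i j (i : Fin (n+5m), j : Fin (8m)) ~ u_{i+1,j+1}, similarly w.

data GV (n m : ℕ) : Set where
  v : Fin (suc (8 * m)) → GV n m
  u : Fin (n + 5 * m) → Fin (8 * m) → GV n m
  w : Fin (n + 5 * m) → Fin (8 * m) → GV n m

-- one orientation of each edge
data GE (n m : ℕ) : GV n m → GV n m → Set where
  e-v0vj : ∀ j → GE n m (v F.zero) (v (F.suc j))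
  e-vjuij : ∀ i j → GE n m (v (F.suc j)) (u i j)
  e-vjwij : ∀ i j → GE n m (v (F.suc j)) (w i j)
  e-uw : ∀ i j j' → j ≢ j' → GE n m (u i j) (w i j')

G : ℕ → ℕ → Graph
G n m = record
  { Vertex = GV n m
  ; Adj = λ x y → GE n m x y ⊎ GE n m y x
  }

-- v₀ is adjacent to every vᵢ, and every uᵢⱼ, wᵢⱼ is adjacent to vⱼ, so v₀ has
-- eccentricity 2. No vertex is adjacent to all others, so every eccentricity is at
-- least 2 and the radius is 2. Inside a layer i, uᵢⱼ and uᵢⱼ' (j ≠ j') have a common
-- neighbour wᵢₖ because 8m ≥ 3 leaves an index k ∉ {j, j'}; the remaining pairs are
-- joined through the vⱼ, which gives diameter at most 3, and uᵢⱼ, uᵢ'ⱼ' with i ≠ i',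
-- j ≠ j' have no common neighbour, so the diameter is exactly 3. Exchanging every uᵢⱼ
-- with wᵢⱼ is an automorphism, so distances from the w side follow from the u side.
module Submission where

open import Defs
open import Data.Nat using (ℕ; _≥_; zero; suc; _+_; _*_; _≤_; z≤n; s≤s)
open import Data.Nat.Properties using (+-suc; +-identityʳ; ≤-refl; ≤-trans; n≤1+n; *-monoʳ-≤; +-mono-≤)
open import Data.Product using (Σ; _×_; _,_; ∃-syntax)
open import Data.Sum using (inj₁; inj₂; swap)
open import Data.Fin using (Fin; _≟_) renaming (zero to fz; suc to fs)
open import Relation.Binary.Definitions using (Symmetric)
open import Relation.Nullary using (¬_; yes; no; contradiction)
open import Relation.Binary.PropositionalEquality using (_≡_; _≢_; refl; subst; subst₂; ≢-sym)

exists-≢ : ∀ {N} → 2 ≤ N → (a : Fin N) → ∃[ c ] c ≢ a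
exists-≢ (s≤s (s≤s _)) fz = fs fz , λ ()
exists-≢ (s≤s (s≤s _)) (fs a) = fz , λ ()

exists-≢₂ : ∀ {N} → 3 ≤ N → (a b : Fin N) → ∃[ c ] (c ≢ a × c ≢ b)
exists-≢₂ (s≤s (s≤s (s≤s _))) fz fz = fs fz , (λ ()) , (λ ())
exists-≢₂ (s≤s (s≤s (s≤s _))) fz (fs fz) = fs (fs fz) , (λ ()) , (λ ())
exists-≢₂ (s≤s (s≤s (s≤s _))) fz (fs (fs b)) = fs fz , (λ ()) , (λ ())
exists-≢₂ (s≤s (s≤s (s≤s _))) (fs fz) fz = fs (fs fz) , (λ ()) , (λ ())
exists-≢₂ (s≤s (s≤s (s≤s _))) (fs fz) (fs b) = fz , (λ ()) , (λ ())
exists-≢₂ (s≤s (s≤s (s≤s _))) (fs (fs a)) fz = fs fz , (λ ()) , (λ ())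
exists-≢₂ (s≤s (s≤s (s≤s _))) (fs (fs a)) (fs b) = fz , (λ ()) , (λ ())

distinct-pair : ∀ {N} → 2 ≤ N → Σ (Fin N) λ a → Σ (Fin N) λ b → a ≢ b
distinct-pair (s≤s (s≤s _)) = fz , fs fz , λ ()

module GraphDistance (G : Graph) where
  open Graph G

  DistAtMost : ℕ → Vertex → Vertex → Set
  DistAtMost b x y = ∃[ k ] (k ≤ b × IsDist G x y k)

  IsDist-refl : ∀ {x} → IsDist G x x 0
  IsDist-refl = nil , λ _ ()

  IsDist-adj : ∀ {x y} → Adj x y → x ≢ y → IsDist G x y 1
  IsDist-adj a x≢y = cons a nil , λ { zero _ nil → x≢y refl ; (suc _) (s≤s ()) _ }

  IsDist-two : ∀ {x y z} → Adj x z → Adj z y → x ≢ y → ¬ Adj x y → IsDist G x y 2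
  IsDist-two a b x≢y x≁y = cons a (cons b nil) , λ
    { zero _ nil → x≢y refl
    ; (suc zero) _ (cons c nil) → x≁y c
    ; (suc (suc _)) (s≤s (s≤s ())) _ }

  IsDist-three : ∀ {x y} → Walk G x y 3 → x ≢ y → ¬ Adj x y → ¬ Walk G x y 2 →
                 IsDist G x y 3
  IsDist-three p x≢y x≁y no-walk₂ = p , λ
    { zero _ nil → x≢y refl
    ; (suc zero) _ (cons c nil) → x≁y c
    ; (suc (suc zero)) _ q → no-walk₂ q
    ; (suc (suc (suc _))) (s≤s (s≤s (s≤s ()))) _ }

  walk-length≥2 : ∀ {x y k} → x ≢ y → ¬ Adj x y → Walk G x y k → 2 ≤ k
  walk-length≥2 x≢y x≁y nil = contradiction refl x≢y
  walk-length≥2 x≢y x≁y (cons a nil) = contradiction a x≁y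
  walk-length≥2 x≢y x≁y (cons a (cons b p)) = s≤s (s≤s z≤n)

  HasNonNeighbour : Vertex → Set
  HasNonNeighbour x = ∃[ y ] (x ≢ y × ¬ Adj x y)

  HasNonNeighbour⇒2≤ecc : ∀ {x e} → HasNonNeighbour x → IsEcc G x e → 2 ≤ e
  HasNonNeighbour⇒2≤ecc (y , x≢y , x≁y) (within , _) with within y
  ... | k , k≤e , p , _ = ≤-trans (walk-length≥2 x≢y x≁y p) k≤e

  module _ (Adj-sym : Symmetric Adj) where

    walk-reverse : ∀ {x y k} → Walk G x y k → Walk G y x k
    walk-reverse {k = k} p = subst (Walk G _ _) (+-identityʳ k) (go p nil)
      where
        go : ∀ {x y z k j} → Walk G x y k → Walk G x z j → Walk G y z (k + j)
        go nil acc = acc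
        go {k = suc k} {j} (cons a p) acc =
          subst (Walk G _ _) (+-suc k j) (go p (cons (Adj-sym a) acc))

    IsDist-sym : ∀ {x y k} → IsDist G x y k → IsDist G y x k
    IsDist-sym (p , shortest) = walk-reverse p , λ j j<k q → shortest j j<k (walk-reverse q)

    DistAtMost-sym : ∀ {b x y} → DistAtMost b x y → DistAtMost b y x
    DistAtMost-sym (k , k≤b , d) = k , k≤b , IsDist-sym d

  module _ (σ : Vertex → Vertex)
           (σ-adj : ∀ {x y} → Adj x y → Adj (σ x) (σ y))
           (σ-involutive : ∀ x → σ (σ x) ≡ x) where

    walk-map : ∀ {x y k} → Walk G x y k → Walk G (σ x) (σ y) k
    walk-map nil = nil
    walk-map (cons a p) = cons (σ-adj a) (walk-map p)

    IsDist-map : ∀ {x y k} → IsDist G x y k → IsDist G (σ x) (σ y) k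
    IsDist-map {x} {y} (p , shortest) = walk-map p , λ j j<k q →
      shortest j j<k (subst₂ (λ a b → Walk G a b j) (σ-involutive x) (σ-involutive y) (walk-map q))

    DistAtMost-map : ∀ {b x y} → DistAtMost b x y → DistAtMost b (σ x) (σ y)
    DistAtMost-map (k , k≤b , d) = k , k≤b , IsDist-map d

module Gnm (n m : ℕ) (3≤indices : 3 ≤ 8 * m) (2≤layers : 2 ≤ n + 5 * m) where
  open Graph (G n m) using (Adj)
  open GraphDistance (G n m)

  Layer : Set
  Layer = Fin (n + 5 * m)
  Index : Set
  Index = Fin (8 * m)

  u≁u : ∀ {i j i' j'} → ¬ Adj (u i j) (u i' j')
  u≁u = λ { (inj₁ ()) ; (inj₂ ()) }

  w≁w : ∀ {i j i' j'} → ¬ Adj (w i j) (w i' j')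
  w≁w = λ { (inj₁ ()) ; (inj₂ ()) }

  v₀≁u : ∀ {i j} → ¬ Adj (v fz) (u i j)
  v₀≁u = λ { (inj₁ ()) ; (inj₂ ()) }

  v₀≁w : ∀ {i j} → ¬ Adj (v fz) (w i j)
  v₀≁w = λ { (inj₁ ()) ; (inj₂ ()) }

  v≁v : ∀ {j j'} → ¬ Adj (v (fs j)) (v (fs j'))
  v≁v = λ { (inj₁ ()) ; (inj₂ ()) }

  v≁u : ∀ {i j j'} → j ≢ j' → ¬ Adj (v (fs j)) (u i j')
  v≁u j≢j' = λ { (inj₁ (e-vjuij _ _)) → j≢j' refl ; (inj₂ ()) }

  u≁w-same-index : ∀ {i i' j} → ¬ Adj (u i j) (w i' j)
  u≁w-same-index = λ { (inj₁ (e-uw _ _ _ j≢j)) → j≢j refl ; (inj₂ ()) }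

  u≁w-other-layer : ∀ {i i' j j'} → i ≢ i' → ¬ Adj (u i j) (w i' j')
  u≁w-other-layer i≢i' = λ { (inj₁ (e-uw _ _ _ _)) → i≢i' refl ; (inj₂ ()) }

  flip-uw : GV n m → GV n m
  flip-uw (v j) = v j
  flip-uw (u i j) = w i j
  flip-uw (w i j) = u i j

  flip-uw-involutive : ∀ x → flip-uw (flip-uw x) ≡ x
  flip-uw-involutive (v j) = refl
  flip-uw-involutive (u i j) = refl
  flip-uw-involutive (w i j) = refl

  flip-uw-edge : ∀ {x y} → GE n m x y → Adj (flip-uw x) (flip-uw y)
  flip-uw-edge (e-v0vj j) = inj₁ (e-v0vj j)
  flip-uw-edge (e-vjuij i j) = inj₁ (e-vjwij i j)
  flip-uw-edge (e-vjwij i j) = inj₁ (e-vjuij i j)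
  flip-uw-edge (e-uw i j j' j≢j') = inj₂ (e-uw i j' j (≢-sym j≢j'))

  flip-uw-adj : ∀ {x y} → Adj x y → Adj (flip-uw x) (flip-uw y)
  flip-uw-adj (inj₁ e) = flip-uw-edge e
  flip-uw-adj (inj₂ e) = swap (flip-uw-edge e)

  DistAtMost-flip-uw : ∀ {b x y} → DistAtMost b x y → DistAtMost b (flip-uw x) (flip-uw y)
  DistAtMost-flip-uw = DistAtMost-map flip-uw flip-uw-adj flip-uw-involutive

  dist-v₀ : ∀ y → DistAtMost 2 (v fz) y
  dist-v₀ (v fz) = 0 , z≤n , IsDist-refl
  dist-v₀ (v (fs j)) = 1 , s≤s z≤n , IsDist-adj (inj₁ (e-v0vj j)) (λ ())
  dist-v₀ (u i j) = 2 , ≤-refl , IsDist-two (inj₁ (e-v0vj j)) (inj₁ (e-vjuij i j)) (λ ()) v₀≁u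
  dist-v₀ (w i j) = 2 , ≤-refl , IsDist-two (inj₁ (e-v0vj j)) (inj₁ (e-vjwij i j)) (λ ()) v₀≁w

  dist-vu : ∀ j i j' → DistAtMost 3 (v (fs j)) (u i j')
  dist-vu j i j' with j ≟ j'
  ... | yes refl = 1 , s≤s z≤n , IsDist-adj (inj₁ (e-vjuij i j)) (λ ())
  ... | no j≢j' = 2 , n≤1+n 2 ,
    IsDist-two (inj₁ (e-vjwij i j)) (inj₂ (e-uw i j' j (≢-sym j≢j'))) (λ ()) (v≁u j≢j')

  dist-v : ∀ x y → DistAtMost 3 (v x) y
  dist-v fz y with dist-v₀ y
  ... | k , k≤2 , d = k , ≤-trans k≤2 (n≤1+n 2) , d
  dist-v (fs j) (v fz) = DistAtMost-sym swap (dist-v fz (v (fs j)))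
  dist-v (fs j) (v (fs j')) with j ≟ j'
  ... | yes refl = 0 , z≤n , IsDist-refl
  ... | no j≢j' = 2 , n≤1+n 2 ,
    IsDist-two (inj₂ (e-v0vj j)) (inj₁ (e-v0vj j')) (λ { refl → j≢j' refl }) v≁v
  dist-v (fs j) (u i j') = dist-vu j i j'
  dist-v (fs j) (w i j') = DistAtMost-flip-uw (dist-vu j i j')

  no-walk₂-u-u : ∀ {i i' j j'} → i ≢ i' → j ≢ j' → ¬ Walk (G n m) (u i j) (u i' j') 2
  no-walk₂-u-u i≢i' j≢j' (cons (inj₁ (e-uw _ _ _ _)) (cons (inj₂ (e-uw _ _ _ _)) nil)) = i≢i' refl
  no-walk₂-u-u i≢i' j≢j' (cons (inj₂ (e-vjuij _ _)) (cons (inj₁ (e-vjuij _ _)) nil)) = j≢j' refl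

  IsDist-u-u : ∀ {i i' j j'} → i ≢ i' → j ≢ j' → IsDist (G n m) (u i j) (u i' j') 3
  IsDist-u-u {i} {i'} {j} {j'} i≢i' j≢j' =
    IsDist-three
      (cons (inj₁ (e-uw i j j' j≢j')) (cons (inj₂ (e-vjwij i j')) (cons (inj₁ (e-vjuij i' j')) nil)))
      (λ { refl → i≢i' refl }) u≁u (no-walk₂-u-u i≢i' j≢j')

  dist-u-u : ∀ i j i' j' → DistAtMost 3 (u i j) (u i' j')
  dist-u-u i j i' j' with i ≟ i' | j ≟ j'
  ... | yes refl | yes refl = 0 , z≤n , IsDist-refl
  ... | no i≢i' | yes refl = 2 , n≤1+n 2 ,
    IsDist-two (inj₂ (e-vjuij i j)) (inj₁ (e-vjuij i' j)) (λ { refl → i≢i' refl }) u≁u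
  ... | yes refl | no j≢j' with exists-≢₂ 3≤indices j j'
  ...   | k , k≢j , k≢j' = 2 , n≤1+n 2 ,
    IsDist-two (inj₁ (e-uw i j k (≢-sym k≢j))) (inj₂ (e-uw i j' k (≢-sym k≢j')))
               (λ { refl → j≢j' refl }) u≁u
  dist-u-u i j i' j' | no i≢i' | no j≢j' = 3 , ≤-refl , IsDist-u-u i≢i' j≢j'

  no-walk₂-u-w : ∀ {i i' j j'} → j ≢ j' → ¬ Walk (G n m) (u i j) (w i' j') 2
  no-walk₂-u-w j≢j' (cons (inj₁ (e-uw _ _ _ _)) (cons (inj₁ ()) nil))
  no-walk₂-u-w j≢j' (cons (inj₁ (e-uw _ _ _ _)) (cons (inj₂ ()) nil))
  no-walk₂-u-w j≢j' (cons (inj₂ (e-vjuij _ _)) (cons (inj₁ (e-vjwij _ _)) nil)) = j≢j' refl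

  dist-u-w : ∀ i j i' j' → DistAtMost 3 (u i j) (w i' j')
  dist-u-w i j i' j' with i ≟ i' | j ≟ j'
  ... | yes refl | yes refl = 2 , n≤1+n 2 ,
    IsDist-two (inj₂ (e-vjuij i j)) (inj₁ (e-vjwij i j)) (λ ()) u≁w-same-index
  ... | yes refl | no j≢j' = 1 , s≤s z≤n , IsDist-adj (inj₁ (e-uw i j j' j≢j')) (λ ())
  ... | no i≢i' | yes refl = 2 , n≤1+n 2 ,
    IsDist-two (inj₂ (e-vjuij i j)) (inj₁ (e-vjwij i' j)) (λ ()) u≁w-same-index
  ... | no i≢i' | no j≢j' = 3 , ≤-refl ,
    IsDist-three
      (cons (inj₂ (e-vjuij i j)) (cons (inj₁ (e-vjuij i' j)) (cons (inj₁ (e-uw i' j j' j≢j')) nil)))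
      (λ ()) (u≁w-other-layer i≢i') (no-walk₂-u-w j≢j')

  dist : ∀ x y → DistAtMost 3 x y
  dist (v x) y = dist-v x y
  dist (u i j) (v x) = DistAtMost-sym swap (dist-v x (u i j))
  dist (w i j) (v x) = DistAtMost-sym swap (dist-v x (w i j))
  dist (u i j) (u i' j') = dist-u-u i j i' j'
  dist (u i j) (w i' j') = dist-u-w i j i' j'
  dist (w i j) (u i' j') = DistAtMost-sym swap (dist-u-w i' j' i j)
  dist (w i j) (w i' j') = DistAtMost-flip-uw (dist-u-u i j i' j')

  some-layer : Layer
  some-layer with distinct-pair 2≤layers
  ... | i , _ = i

  some-index : Index
  some-index with distinct-pair (≤-trans (n≤1+n 2) 3≤indices)
  ... | j , _ = j

  has-non-neighbour : ∀ x → HasNonNeighbour x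
  has-non-neighbour (v fz) = u some-layer some-index , (λ ()) , v₀≁u
  has-non-neighbour (v (fs j)) with exists-≢ (≤-trans (n≤1+n 2) 3≤indices) j
  ... | k , k≢j = u some-layer k , (λ ()) , v≁u (≢-sym k≢j)
  has-non-neighbour (u i j) with exists-≢ 2≤layers i
  ... | i' , i'≢i = u i' j , (λ { refl → i'≢i refl }) , u≁u
  has-non-neighbour (w i j) with exists-≢ 2≤layers i
  ... | i' , i'≢i = w i' j , (λ { refl → i'≢i refl }) , w≁w

  2≤ecc : ∀ x e → IsEcc (G n m) x e → 2 ≤ e
  2≤ecc x _ = HasNonNeighbour⇒2≤ecc (has-non-neighbour x)

  ecc-v₀ : IsEcc (G n m) (v fz) 2
  ecc-v₀ = dist-v₀ , u some-layer some-index , IsDist-two (inj₁ (e-v0vj some-index))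
    (inj₁ (e-vjuij some-layer some-index)) (λ ()) v₀≁u

  diameter-witness : ∃[ x ] ∃[ y ] IsDist (G n m) x y 3
  diameter-witness with distinct-pair 2≤layers | distinct-pair (≤-trans (n≤1+n 2) 3≤indices)
  ... | i , i' , i≢i' | j , j' , j≢j' = u i j , u i' j' , IsDist-u-u i≢i' j≢j'

lemma2 : ∀ (n m : ℕ) → n ≥ 1 → m ≥ 1 →
    HasDiameter (G n m) 3 × HasRadius (G n m) 2
lemma2 n m n≥1 m≥1 =
    (dist , diameter-witness)
  , ((v fz , ecc-v₀) , 2≤ecc)
  where
    3≤indices : 3 ≤ 8 * m
    3≤indices = ≤-trans (s≤s (s≤s (s≤s z≤n))) (*-monoʳ-≤ 8 m≥1)
    2≤layers : 2 ≤ n + 5 * m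
    2≤layers = ≤-trans (s≤s (s≤s z≤n)) (+-mono-≤ n≥1 (*-monoʳ-≤ 5 m≥1))
    open Gnm n m 3≤indices 2≤layers
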